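{- Let $n$ be a positive integer and let $\chi:E(K_n)\to\mathbb{Z}_3$ be a coloring with no alternating $4$-cycle. Then $\chi$ is a CC coloring.
   Context: A $4$-cycle is alternating if the sums of the colors on its two perfect matchings are distinct. A coloring $\chi:E(K_N)\to\mathbb{Z}_3$ is a CC coloring if $V(K_N)$ can be partitioned into three (possibly empty) sets $V_0,V_1,V_2$ such that for each $i\in\{0,1,2\}$ the edges of color $i$ are exactly the edges inside $V_i$ together with the edges joining $V_{i+1}$ and $V_{i+2}$ (indices modulo $3$). -}

module Defs where

open import Data.Nat using (ℕ; zero; suc)
open import Data.Fin using (Fin; zero; suc)
open import Data.Product using (_×_; Σ)
open import Data.Sum using (_⊎_)
open import Relation.Binary.PropositionalEquality using (_≡_; _≢_)
open import Relation.Nullary using (¬_)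

ℤ₃ : Set
ℤ₃ = Fin 3

inc : ℤ₃ → ℤ₃
inc zero = suc zero
inc (suc zero) = suc (suc zero)
inc (suc (suc zero)) = zero

_+₃_ : ℤ₃ → ℤ₃ → ℤ₃
zero +₃ y = y
suc zero +₃ y = inc y
suc (suc zero) +₃ y = inc (inc y)

-- A colouring of E(K_n) with colours in ℤ₃: a function on ordered pairs of
-- vertices that is symmetric; its values on the diagonal (u,u) are
-- irrelevant (never used), since K_n has no loops.
record Coloring (n : ℕ) : Set where
  field
    col : Fin n → Fin n → ℤ₃
    sym : ∀ u v → col u v ≡ col v u
open Coloring public

Alternating : ∀ {n} → Coloring n → (a b c d : Fin n) → Set
Alternating χ a b c d =
  (a ≢ b) × (a ≢ c) × (a ≢ d) × (b ≢ c) × (b ≢ d) × (c ≢ d) ×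
  ((col χ a b +₃ col χ c d) ≢ (col χ b c +₃ col χ d a))

NoAlternating4Cycle : ∀ {n} → Coloring n → Set
NoAlternating4Cycle {n} χ = ∀ (a b c d : Fin n) → ¬ Alternating χ a b c d

-- χ is a CC colouring if there is a partition V₀,V₁,V₂ of the vertices
-- (given by part : Fin n → ℤ₃, V_i = part⁻¹(i), possibly empty) such that
-- for every colour i and every edge uv (u ≠ v): χ(uv) = i iff uv lies
-- inside V_i or joins V_{i+1} and V_{i+2}.
IsCC : ∀ {n} → Coloring n → Set
IsCC {n} χ =
  Σ (Fin n → ℤ₃) λ part →
    ∀ (i : ℤ₃) (u v : Fin n) → u ≢ v →
      (col χ u v ≡ i →
         (part u ≡ i × part v ≡ i)
         ⊎ (part u ≡ inc i × part v ≡ inc (inc i))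
         ⊎ (part u ≡ inc (inc i) × part v ≡ inc i))
      × ((part u ≡ i × part v ≡ i)
         ⊎ (part u ≡ inc i × part v ≡ inc (inc i))
         ⊎ (part u ≡ inc (inc i) × part v ≡ inc i)
         → col χ u v ≡ i)

{-# OPTIONS --safe #-}
-- Fix a vertex 0.  A balanced 4-cycle i–j–0–k says exactly that
-- χ(ij) − χ(0i) − χ(0j) does not depend on j, so by symmetry this quantity is
-- one constant γ on all edges avoiding 0.  Hence χ(uv) = g(u) + g(v) with
-- g(0) = γ and g(i) = χ(0i) − γ (using −2γ = γ in ℤ₃).  Every such sum
-- colouring is CC with V_k = g⁻¹(−k): the solutions of p + q ≡ −i in ℤ₃ are
-- exactly (i,i), (i+1,i+2) and (i+2,i+1).
module Submission where

open import Defs hiding (sym)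
open import Data.Nat using (ℕ; suc)
open import Data.Fin using (Fin; zero; suc; _≟_)
open import Data.Fin.Properties using (all?; suc-injective)
open import Data.Product using (_×_; _,_; Σ; proj₁; proj₂)
open import Data.Sum using (_⊎_)
open import Data.Empty using (⊥-elim)
open import Function using (_∘_)
open import Relation.Binary.PropositionalEquality using (_≡_; _≢_; refl; sym; trans; cong; cong₂)
open import Relation.Binary.Definitions using (DecidableEquality)
open import Relation.Nullary using (Dec; yes; no)
open import Relation.Nullary.Decidable using (from-yes; decidable-stable; _×-dec_; _⊎-dec_; _→-dec_)

-₃_ : ℤ₃ → ℤ₃
-₃ zero = zero
-₃ suc zero = suc (suc zero)
-₃ suc (suc zero) = suc zero

_-₃_ : ℤ₃ → ℤ₃ → ℤ₃
x -₃ y = x +₃ (-₃ y)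

+₃≡+₃⇒-₃≡-₃ : ∀ x y a d e → x +₃ d ≡ e +₃ y → (x -₃ a) -₃ e ≡ (y -₃ a) -₃ d
+₃≡+₃⇒-₃≡-₃ = from-yes (all? λ x → all? λ y → all? λ a → all? λ d → all? λ e →
  (x +₃ d ≟ e +₃ y) →-dec ((x -₃ a) -₃ e ≟ (y -₃ a) -₃ d))

-₃-swap : ∀ x a b → (x -₃ a) -₃ b ≡ (x -₃ b) -₃ a
-₃-swap = from-yes (all? λ x → all? λ a → all? λ b → (x -₃ a) -₃ b ≟ (x -₃ b) -₃ a)

a+₃[x-₃a]≡x : ∀ a x → a +₃ (x -₃ a) ≡ x
a+₃[x-₃a]≡x = from-yes (all? λ a → all? λ x → a +₃ (x -₃ a) ≟ x)

[x-₃a]+₃a≡x : ∀ a x → (x -₃ a) +₃ a ≡ x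
[x-₃a]+₃a≡x = from-yes (all? λ a → all? λ x → (x -₃ a) +₃ a ≟ x)

[x-₃a]-₃b≡γ⇒x≡[a-₃γ]+₃[b-₃γ] : ∀ x a b γ → (x -₃ a) -₃ b ≡ γ → x ≡ (a -₃ γ) +₃ (b -₃ γ)
[x-₃a]-₃b≡γ⇒x≡[a-₃γ]+₃[b-₃γ] = from-yes (all? λ x → all? λ a → all? λ b → all? λ γ →
  ((x -₃ a) -₃ b ≟ γ) →-dec (x ≟ (a -₃ γ) +₃ (b -₃ γ)))

CCParts : ℤ₃ → ℤ₃ → ℤ₃ → Set
CCParts i p q = (p ≡ i × q ≡ i) ⊎ (p ≡ inc i × q ≡ inc (inc i)) ⊎ (p ≡ inc (inc i) × q ≡ inc i)

ccParts? : ∀ i p q → Dec (CCParts i p q)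
ccParts? i p q = ((p ≟ i) ×-dec (q ≟ i)) ⊎-dec ((p ≟ inc i) ×-dec (q ≟ inc (inc i)))
                   ⊎-dec ((p ≟ inc (inc i)) ×-dec (q ≟ inc i))

a+₃b≡i⇔CCParts : ∀ i a b → (a +₃ b ≡ i → CCParts i (-₃ a) (-₃ b)) × (CCParts i (-₃ a) (-₃ b) → a +₃ b ≡ i)
a+₃b≡i⇔CCParts = from-yes (all? λ i → all? λ a → all? λ b →
  ((a +₃ b ≟ i) →-dec ccParts? i (-₃ a) (-₃ b)) ×-dec (ccParts? i (-₃ a) (-₃ b) →-dec (a +₃ b ≟ i)))

IsSumColoring : ∀ {n} → Coloring n → Set
IsSumColoring {n} χ = Σ (Fin n → ℤ₃) λ g → ∀ u v → u ≢ v → col χ u v ≡ g u +₃ g v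

sumColoring⇒CC : ∀ {n} (χ : Coloring n) → IsSumColoring χ → IsCC χ
sumColoring⇒CC χ (g , col≡g) = (λ u → -₃ g u) , λ i u v u≢v → transport i (col≡g u v u≢v)
  where
  transport : ∀ i {c a b} → c ≡ a +₃ b → (c ≡ i → CCParts i (-₃ a) (-₃ b)) × (CCParts i (-₃ a) (-₃ b) → c ≡ i)
  transport i {a = a} {b} refl = a+₃b≡i⇔CCParts i a b

module _ {A B : Set} (_≟ᴬ_ : DecidableEquality A) (h : A → A → B)
         (h-sym : ∀ i j → h i j ≡ h j i)
         (h-row : ∀ {i j k} → i ≢ j → i ≢ k → j ≢ k → h i j ≡ h i k) where

  private
    h-row′ : ∀ {i j k} → i ≢ j → i ≢ k → h i j ≡ h i k
    h-row′ {j = j} {k} i≢j i≢k with j ≟ᴬ k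
    ... | yes refl = refl
    ... | no j≢k = h-row i≢j i≢k j≢k

  constantOnDistinctPairs : ∀ {i j k l} → i ≢ j → k ≢ l → h i j ≡ h k l
  constantOnDistinctPairs {i} {j} {k} {l} i≢j k≢l with i ≟ᴬ k
  ... | yes refl = h-row′ i≢j k≢l
  ... | no i≢k = trans (h-row′ i≢j i≢k) (trans (h-sym i k) (h-row′ (λ k≡i → i≢k (sym k≡i)) k≢l))

valueOnDistinctPairs : ∀ {n} {B : Set} → B → (h : Fin n → Fin n → B) →
                       (∀ {i j k l} → i ≢ j → k ≢ l → h i j ≡ h k l) →
                       Σ B λ γ → ∀ {i j} → i ≢ j → h i j ≡ γ
valueOnDistinctPairs {0} b h _ = b , λ { {()} }
valueOnDistinctPairs {1} b h _ = b , λ { {zero} {zero} i≢i → ⊥-elim (i≢i refl) }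
valueOnDistinctPairs {suc (suc n)} _ h const = h zero (suc zero) , λ i≢j → const i≢j (λ ())

noAlternating⇒balanced : ∀ {n} (χ : Coloring n) → NoAlternating4Cycle χ →
                         ∀ {a b c d} → a ≢ b → a ≢ c → a ≢ d → b ≢ c → b ≢ d → c ≢ d →
                         col χ a b +₃ col χ c d ≡ col χ b c +₃ col χ d a
noAlternating⇒balanced χ noAlt {a} {b} {c} {d} a≢b a≢c a≢d b≢c b≢d c≢d =
  decidable-stable (_ ≟ _) λ unbalanced → noAlt a b c d (a≢b , a≢c , a≢d , b≢c , b≢d , c≢d , unbalanced)

noAlternating⇒sumColoring : ∀ {n} (χ : Coloring (suc n)) → NoAlternating4Cycle χ → IsSumColoring χ
noAlternating⇒sumColoring {n} χ noAlt = g , col≡g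
  where
  suc≢suc : ∀ {m} {i j : Fin m} → i ≢ j → suc i ≢ suc j
  suc≢suc i≢j = i≢j ∘ suc-injective

  excess : Fin n → Fin n → ℤ₃
  excess i j = (col χ (suc i) (suc j) -₃ col χ zero (suc i)) -₃ col χ zero (suc j)

  excess-sym : ∀ i j → excess i j ≡ excess j i
  excess-sym i j = trans (-₃-swap (col χ (suc i) (suc j)) (col χ zero (suc i)) (col χ zero (suc j)))
    (cong (λ x → (x -₃ col χ zero (suc j)) -₃ col χ zero (suc i)) (Coloring.sym χ (suc i) (suc j)))

  excess-row : ∀ {i j k} → i ≢ j → i ≢ k → j ≢ k → excess i j ≡ excess i k
  excess-row {i} {j} {k} i≢j i≢k j≢k =
    +₃≡+₃⇒-₃≡-₃ (col χ (suc i) (suc j)) (col χ (suc i) (suc k))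
                 (col χ zero (suc i)) (col χ zero (suc k)) (col χ zero (suc j)) cycle
    where
    cycle : col χ (suc i) (suc j) +₃ col χ zero (suc k) ≡ col χ zero (suc j) +₃ col χ (suc i) (suc k)
    cycle = trans
      (noAlternating⇒balanced χ noAlt {suc i} {suc j} {zero} {suc k}
         (suc≢suc i≢j) (λ ()) (suc≢suc i≢k) (λ ()) (suc≢suc j≢k) (λ ()))
      (cong₂ _+₃_ (Coloring.sym χ (suc j) zero) (Coloring.sym χ (suc k) (suc i)))

  excessValue : Σ ℤ₃ λ γ → ∀ {i j} → i ≢ j → excess i j ≡ γ
  excessValue = valueOnDistinctPairs zero excess (constantOnDistinctPairs _≟_ excess excess-sym excess-row)

  γ : ℤ₃
  γ = proj₁ excessValue

  excess≡γ : ∀ {i j} → i ≢ j → excess i j ≡ γ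
  excess≡γ = proj₂ excessValue

  g : Fin (suc n) → ℤ₃
  g zero = γ
  g (suc i) = col χ zero (suc i) -₃ γ

  col≡g : ∀ u v → u ≢ v → col χ u v ≡ g u +₃ g v
  col≡g zero zero u≢u = ⊥-elim (u≢u refl)
  col≡g zero (suc j) _ = sym (a+₃[x-₃a]≡x γ _)
  col≡g (suc i) zero _ = trans (Coloring.sym χ _ _) (sym ([x-₃a]+₃a≡x γ _))
  col≡g (suc i) (suc j) i≢j = [x-₃a]-₃b≡γ⇒x≡[a-₃γ]+₃[b-₃γ] _ _ _ γ (excess≡γ (i≢j ∘ cong suc))

lemma4p5 : (n : ℕ) → (χ : Coloring (suc n)) → NoAlternating4Cycle χ → IsCC χ
lemma4p5 n χ noAlt = sumColoring⇒CC χ (noAlternating⇒sumColoring χ noAlt)
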